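{- Let $n\ge2$ and $\tau_i=(c_i,d_i,p_i,J_i)$, $i=1,\dots,n$, nonnegative integers with $c_i\ge1$, $p_i\ge1$, $c_i\le d_i\le p_i$, $0\le J_i\le p_i$, and $\sum_{i<n}c_i/p_i<1$. Let $I\subseteq\{1,\dots,n-1\}$ and let $k$ be an integer. Define \[ \overline{\mathcal{R}}(I,k)=\max\Big\{t-\sum_{i\in I}c_ix_i : t\le k,\ p_ix_i\ge t+J_i\ \forall i\in I,\ t\in\mathbb{Z}_{\ge0},\ x\in\mathbb{Z}^I\Big\} \] and \[ \mathcal{M}(I,k)=\min\Big\{s+\sum_{i\in I}c_ix_i : s+p_ix_i\ge k+J_i\ \forall i\in I,\ s\in\mathbb{Z}_{\ge0},\ x\in\mathbb{Z}^I\Big\}, \] and let $S$ be the largest value of $s$ among all optimal solutions $(s,x)$ of $\mathcal{M}(I,k)$. If $k\ge S$, then $\overline{\mathcal{R}}(I,k)=k-\mathcal{M}(I,k)$. -}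

module Defs where

open import Data.Nat as ℕ using (ℕ; _∸_; >-nonZero)
open import Data.Integer as ℤ using (ℤ; +_; _-_; _*_; _+_; _≤_)
open import Data.Rational as ℚ using (ℚ; 0ℚ)
open import Data.Fin using (Fin; toℕ)
open import Data.Fin.Subset using (Subset; _∈_)
open import Data.Vec using (lookup)
open import Data.List using (List; foldr; map; allFin)
open import Data.Bool using (if_then_else_)
open import Data.Product using (Σ; _×_; ∃₂)
open import Relation.Binary.PropositionalEquality using (_≡_)

-- Indices: tasks 1..n are represented by Fin n (0-based); task i (1-based) is
-- the element with toℕ = i - 1.  "i < n" (1-based) means toℕ i < n ∸ 1.

sumI : ∀ {n} → Subset n → (Fin n → ℤ) → ℤ
sumI {n} I f = foldr ℤ._+_ (+ 0) (map (λ i → if lookup I i then f i else + 0) (allFin n))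

utilisation : (n : ℕ) (c p : Fin n → ℕ) → (∀ i → 1 ℕ.≤ p i) → ℚ
utilisation n c p p≥1 =
  foldr ℚ._+_ 0ℚ
    (map (λ i → if toℕ i ℕ.<ᵇ n ∸ 1
                  then ((+ c i) ℚ./ p i) {{>-nonZero (p≥1 i)}}
                  else 0ℚ)
         (allFin n))

module _ {n : ℕ} (c p J : Fin n → ℕ) (I : Subset n) (k : ℤ) where

  RFeasible : ℕ → (Fin n → ℤ) → Set
  RFeasible t x = (+ t ≤ k) × (∀ i → i ∈ I → + t + + J i ≤ + p i * x i)

  RObj : ℕ → (Fin n → ℤ) → ℤ
  RObj t x = + t - sumI I (λ i → + c i * x i)

  IsRbarMax : ℤ → Set
  IsRbarMax r =
    (∃₂ λ t x → RFeasible t x × RObj t x ≡ r) ×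
    (∀ t x → RFeasible t x → RObj t x ≤ r)

  MFeasible : ℕ → (Fin n → ℤ) → Set
  MFeasible s x = ∀ i → i ∈ I → k + + J i ≤ + s + + p i * x i

  MObj : ℕ → (Fin n → ℤ) → ℤ
  MObj s x = + s + sumI I (λ i → + c i * x i)

  IsMMin : ℤ → Set
  IsMMin m =
    (∃₂ λ s x → MFeasible s x × MObj s x ≡ m) ×
    (∀ s x → MFeasible s x → m ≤ MObj s x)

  IsLargestOptimalS : ℤ → ℕ → Set
  IsLargestOptimalS m S =
    (Σ (Fin n → ℤ) λ x → MFeasible S x × MObj S x ≡ m) ×
    (∀ s x → MFeasible s x → MObj s x ≡ m → s ℕ.≤ S)

{-# OPTIONS --safe #-}
-- The substitution s = k − t identifies the two integer programs: (t, x) is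
-- feasible for R̄(I,k) exactly when (k − t, x) is feasible for M(I,k), and the
-- objectives satisfy t − Σ cᵢxᵢ = k − (s + Σ cᵢxᵢ).  The side condition t ≥ 0 of
-- R̄ becomes s ≤ k, which is why an optimal solution with s = S ≤ k is needed.
module Submission where

open import Defs
open import Data.Nat as ℕ using (ℕ; _∸_)
open import Data.Integer as ℤ using (ℤ; +_; _-_)
open import Data.Rational as ℚ using (1ℚ)
open import Data.Fin using (Fin; toℕ)
open import Data.Fin.Subset using (Subset; _∈_)
open import Data.Integer using (_+_; -_; _≤_; +≤+)
import Data.Integer.Properties as ℤ
import Data.Nat.Properties as ℕ
open import Data.List using (_∷_; [])
open import Data.Product using (_,_)
open import Relation.Binary.PropositionalEquality using (_≡_; refl; sym; trans; cong; subst)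
open import Data.Integer.Tactic.RingSolver using (solve)

+-cancelˡ-≤ : ∀ b {x y} → b + x ≤ b + y → x ≤ y
+-cancelˡ-≤ b {x} {y} b+x≤b+y = begin
  x                ≡⟨ solve (b ∷ x ∷ []) ⟩
  - b + (b + x)    ≤⟨ ℤ.+-monoʳ-≤ (- b) b+x≤b+y ⟩
  - b + (b + y)    ≡⟨ solve (b ∷ y ∷ []) ⟩
  y                ∎
  where open ℤ.≤-Reasoning

[b+t]-[b+σ]≡t-σ : ∀ b t σ → (b + t) - (b + σ) ≡ t - σ
[b+t]-[b+σ]≡t-σ b t σ = solve (b ∷ t ∷ σ ∷ [])

minus-monoʳ-≤ : ∀ a {x y} → x ≤ y → a - y ≤ a - x
minus-monoʳ-≤ a x≤y = ℤ.+-monoʳ-≤ a (ℤ.neg-mono-≤ x≤y)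

module _ {n : ℕ} (c p J : Fin n → ℕ) (I : Subset n) where

  RFeasible⇒MFeasible : ∀ {s t k} → s ℕ.+ t ≡ k → ∀ x →
                        RFeasible c p J I (+ k) t x → MFeasible c p J I (+ k) s x
  RFeasible⇒MFeasible {s} {t} refl x (_ , t+Jᵢ≤pᵢxᵢ) i i∈I = begin
    + s + + t + + J i      ≡⟨ ℤ.+-assoc (+ s) (+ t) (+ J i) ⟩
    + s + (+ t + + J i)    ≤⟨ ℤ.+-monoʳ-≤ (+ s) (t+Jᵢ≤pᵢxᵢ i i∈I) ⟩
    + s + + p i ℤ.* x i    ∎
    where open ℤ.≤-Reasoning

  MFeasible⇒RFeasible : ∀ {s t k} → s ℕ.+ t ≡ k → ∀ x →
                        MFeasible c p J I (+ k) s x → RFeasible c p J I (+ k) t x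
  MFeasible⇒RFeasible {s} {t} refl x k+Jᵢ≤s+pᵢxᵢ =
    +≤+ (ℕ.m≤n+m t s) ,
    λ i i∈I → +-cancelˡ-≤ (+ s)
      (subst (_≤ + s + + p i ℤ.* x i) (ℤ.+-assoc (+ s) (+ t) (+ J i)) (k+Jᵢ≤s+pᵢxᵢ i i∈I))

  RObj≡k-MObj : ∀ {s t k} → s ℕ.+ t ≡ k → ∀ x →
                RObj c p J I (+ k) t x ≡ + k - MObj c p J I (+ k) s x
  RObj≡k-MObj {s} {t} refl x = sym ([b+t]-[b+σ]≡t-σ (+ s) (+ t) (sumI I (λ i → + c i ℤ.* x i)))

  IsRbarMax-complement : ∀ {k m S} x → S ℕ.≤ k →
                         MFeasible c p J I (+ k) S x → MObj c p J I (+ k) S x ≡ m →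
                         (∀ s y → MFeasible c p J I (+ k) s y → m ≤ MObj c p J I (+ k) s y) →
                         IsRbarMax c p J I (+ k) (+ k - m)
  IsRbarMax-complement {k} {m} {S} x S≤k S-feasible S-optimal m-lower =
    (k ∸ S , x , MFeasible⇒RFeasible S+[k∸S]≡k x S-feasible , attained) , bounded
    where
    S+[k∸S]≡k : S ℕ.+ (k ∸ S) ≡ k
    S+[k∸S]≡k = ℕ.m+[n∸m]≡n S≤k

    attained : RObj c p J I (+ k) (k ∸ S) x ≡ + k - m
    attained = trans (RObj≡k-MObj S+[k∸S]≡k x) (cong (_-_ (+ k)) S-optimal)

    bounded : ∀ t y → RFeasible c p J I (+ k) t y → RObj c p J I (+ k) t y ≤ + k - m
    bounded t y t-feasible@(+≤+ t≤k , _) = begin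
      RObj c p J I (+ k) t y              ≡⟨ RObj≡k-MObj k∸t+t≡k y ⟩
      + k - MObj c p J I (+ k) (k ∸ t) y  ≤⟨ minus-monoʳ-≤ (+ k) (m-lower (k ∸ t) y k∸t-feasible) ⟩
      + k - m                             ∎
      where
      open ℤ.≤-Reasoning
      k∸t+t≡k : (k ∸ t) ℕ.+ t ≡ k
      k∸t+t≡k = ℕ.m∸n+n≡m t≤k

      k∸t-feasible : MFeasible c p J I (+ k) (k ∸ t) y
      k∸t-feasible = RFeasible⇒MFeasible k∸t+t≡k y t-feasible

lemma10 : (n : ℕ) → 2 ℕ.≤ n →
          (c d p J : Fin n → ℕ) →
          (∀ i → 1 ℕ.≤ c i) →
          (p≥1 : ∀ i → 1 ℕ.≤ p i) →
          (∀ i → c i ℕ.≤ d i) → (∀ i → d i ℕ.≤ p i) →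
          (∀ i → J i ℕ.≤ p i) →
          utilisation n c p p≥1 ℚ.< 1ℚ →
          (I : Subset n) → (∀ i → i ∈ I → toℕ i ℕ.< n ∸ 1) →
          (k : ℤ) →
          (m : ℤ) → IsMMin c p J I k m →
          (S : ℕ) → IsLargestOptimalS c p J I k m S →
          + S ℤ.≤ k →
          IsRbarMax c p J I k (k - m)
lemma10 _ _ c _ p J _ _ _ _ _ _ I _ (+ _) _ (_ , m-lower) _ ((x , S-feasible , S-optimal) , _) (+≤+ S≤k) =
  IsRbarMax-complement c p J I x S≤k S-feasible S-optimal m-lower
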